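{- Let $(\mathbb{D},G)$ be a data symmetry. In any reachable deterministic $G$-automaton whose input alphabet $A$ is a nominal $G$-set, the $G$-set of states is nominal.
   Context: A data symmetry $(\mathbb{D},G)$ is a set $\mathbb{D}$ together with a subgroup $G$ of the group of all bijections of $\mathbb{D}$; $G$ acts on $\mathbb{D}$ by $d\cdot\pi=\pi(d)$. A $G$-set is a set with a right action of $G$ ($x\cdot e=x$, $x\cdot(\pi\sigma)=(x\cdot\pi)\cdot\sigma$); equivariant sets/functions are those invariant under the action (pointwise on products). A set $C\subseteq\mathbb{D}$ supports $x$ in a $G$-set $X$ if $x\cdot\pi=x$ for every $\pi\in G$ with $\pi(c)=c$ for all $c\in C$; $X$ is nominal if every element has a finite support. A deterministic $G$-automaton consists of an orbit finite $G$-set $A$ (finitely many orbits), a $G$-set $Q$ of states, an initial state $q_I$ fixed by all of $G$, an equivariant set $F\subseteq Q$ of accepting states, and an equivariant transition function $\delta:Q\times A\to Q$; it is reachable if every state equals $\delta^*(q_I,w)$ for some $w\in A^*$, where $\delta^*$ is the extension of $\delta$ to words. -}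

module Defs where

open import Data.List using (List; []; _∷_)
open import Data.List.Membership.Propositional using (_∈_)
open import Data.Product using (Σ; ∃; _×_; _,_; proj₁)
open import Function using (_↔_; Inverse; _⇔_)
open import Function.Construct.Identity using (↔-id)
open import Function.Construct.Composition using (_↔-∘_)
open import Function.Construct.Symmetry using (↔-sym)
open import Relation.Binary.PropositionalEquality using (_≡_)

-- A data symmetry (𝔻 , G): a set 𝔻 and a subgroup G of the group of all
-- bijections 𝔻 ↔ 𝔻, given as a membership predicate closed under identity,
-- composition and inverses, and depending only on the underlying function.
record DataSymmetry : Set₁ where
  field
    𝔻      : Set
    InG    : 𝔻 ↔ 𝔻 → Set
    ext    : ∀ {π π′} → (∀ d → Inverse.to π d ≡ Inverse.to π′ d) → InG π → InG π′
    id∈    : InG (↔-id 𝔻)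
    comp∈  : ∀ {π σ} → InG π → InG σ → InG (σ ↔-∘ π)
    inv∈   : ∀ {π} → InG π → InG (↔-sym π)

module _ (S : DataSymmetry) where
  open DataSymmetry S

  Perm : Set
  Perm = Σ (𝔻 ↔ 𝔻) InG

  app : Perm → 𝔻 → 𝔻
  app (π , _) = Inverse.to π

  e : Perm
  e = ↔-id 𝔻 , id∈

  -- product πσ acting on the right: d·(πσ) = (d·π)·σ = σ(π(d))
  _∙_ : Perm → Perm → Perm
  (π , p) ∙ (σ , s) = (σ ↔-∘ π) , comp∈ p s

  record GSet : Set₁ where
    field
      Carrier : Set
      _·_     : Carrier → Perm → Carrier
      act-e   : ∀ x → x · e ≡ x
      act-∙   : ∀ x π σ → x · (π ∙ σ) ≡ (x · π) · σ
      -- the action depends only on the group element (the bijection)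
      act-ext : ∀ x π σ → (∀ d → app π d ≡ app σ d) → x · π ≡ x · σ

  open GSet public

  Supports : (X : GSet) → List 𝔻 → Carrier X → Set
  Supports X C x = ∀ (π : Perm) → (∀ c → c ∈ C → app π c ≡ c) → _·_ X x π ≡ x

  Nominal : GSet → Set
  Nominal X = ∀ (x : Carrier X) → ∃ λ (C : List 𝔻) → Supports X C x

  OrbitFinite : GSet → Set
  OrbitFinite X = ∃ λ (reps : List (Carrier X)) →
    ∀ (x : Carrier X) → ∃ λ r → r ∈ reps × ∃ λ (π : Perm) → x ≡ _·_ X r π

  δ* : {Q A : Set} → (Q → A → Q) → Q → List A → Q
  δ* δ q []       = q
  δ* δ q (a ∷ w) = δ* δ (δ q a) w

  record GAutomaton : Set₁ where
    field
      A       : GSet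
      A-orbit-finite : OrbitFinite A
      Q       : GSet
      qI      : Carrier Q
      qI-fixed : ∀ π → _·_ Q qI π ≡ qI
      F       : Carrier Q → Set
      F-equiv : ∀ q π → F q ⇔ F (_·_ Q q π)
      δ       : Carrier Q → Carrier A → Carrier Q
      δ-equiv : ∀ q a π → δ (_·_ Q q π) (_·_ A a π) ≡ _·_ Q (δ q a) π

  Reachable : GAutomaton → Set
  Reachable M = ∀ (q : Carrier Q) → ∃ λ (w : List (Carrier A)) → δ* δ qI w ≡ q
    where open GAutomaton M

-- A state is reached by reading a word a₁…aₙ from the invariant initial state,
-- and δ is equivariant, so the union of finite supports of a₁, …, aₙ supports it.
module Submission where

open import Defs
open import Data.List using (List; []; _∷_; _++_)
open import Data.List.Relation.Binary.Subset.Propositional using (_⊆_)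
open import Data.List.Relation.Binary.Subset.Propositional.Properties
  using (xs⊆xs++ys; xs⊆ys++xs)
open import Data.Product using (∃; _,_)
open import Relation.Binary.PropositionalEquality using (_≡_; refl; sym; trans; cong₂)

module _ (S : DataSymmetry) where

  Supports-mono : (X : GSet S) {C D : List (DataSymmetry.𝔻 S)} {x : Carrier X} →
                  C ⊆ D → Supports S X C x → Supports S X D x
  Supports-mono X C⊆D supp π fixD = supp π (λ c c∈C → fixD c (C⊆D c∈C))

  Supports-[]-invariant : (X : GSet S) {x : Carrier X} →
                          (∀ π → _·_ X x π ≡ x) → Supports S X [] x
  Supports-[]-invariant X inv π _ = inv π

  Supports-equivariant₂ :
    (X Y Z : GSet S) (f : Carrier X → Carrier Y → Carrier Z) →
    (∀ x y π → f (_·_ X x π) (_·_ Y y π) ≡ _·_ Z (f x y) π) →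
    ∀ {C D x y} → Supports S X C x → Supports S Y D y → Supports S Z (C ++ D) (f x y)
  Supports-equivariant₂ X Y Z f f-equiv {C} {D} {x} {y} suppC suppD π fix =
    trans (sym (f-equiv x y π))
          (cong₂ f (Supports-mono X (xs⊆xs++ys C D) suppC π fix)
                   (Supports-mono Y (xs⊆ys++xs D C) suppD π fix))

  module _ (M : GAutomaton S) (A-nominal : Nominal S (GAutomaton.A M)) where
    open GAutomaton M

    δ*-finitely-supported : ∀ {q C} → Supports S Q C q →
                            ∀ w → ∃ λ D → Supports S Q D (δ* S δ q w)
    δ*-finitely-supported {C = C} supp []      = C , supp
    δ*-finitely-supported         supp (a ∷ w) with A-nominal a
    ... | _ , suppA =
      δ*-finitely-supported (Supports-equivariant₂ Q A Q δ δ-equiv supp suppA) w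

proposition5p1 : (S : DataSymmetry) (M : GAutomaton S) →
                 Reachable S M → Nominal S (GAutomaton.A M) →
                 Nominal S (GAutomaton.Q M)
proposition5p1 S M reachable A-nominal q with reachable q
... | w , refl =
  δ*-finitely-supported S M A-nominal
    (Supports-[]-invariant S (GAutomaton.Q M) (GAutomaton.qI-fixed M)) w
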